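{- Let $S$ be a connected graph. Then every connected $S$-free graph $G$ is super-edge-connected if and only if $S$ is an induced subgraph of $P_3$.
   Context: All graphs are finite and simple. For a graph $H$, a graph $G$ is $H$-free if $G$ contains no induced subgraph isomorphic to $H$. An edge-cut of $G$ is a set $F\subseteq E(G)$ such that $G-F$ is disconnected; the edge-connectivity $\kappa'(G)$ is the minimum size of an edge-cut. A connected graph $G$ is super-edge-connected if every minimum edge-cut of $G$ isolates a vertex, i.e. every edge-cut of size $\kappa'(G)$ is the set of all edges incident with some single vertex of $G$. $P_n$ denotes the path on $n$ vertices. -}

module Defs where

open import Data.Nat using (ℕ; zero; suc; _+_; _≤_; _<ᵇ_)
open import Data.Fin using (Fin; zero; suc; toℕ)
open import Data.Bool using (Bool; true; false; _∧_; not; if_then_else_)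
open import Data.Product using (Σ; ∃; _×_; _,_)
open import Data.Sum using (_⊎_)
open import Relation.Binary.PropositionalEquality using (_≡_)
open import Relation.Nullary using (¬_)
open import Function.Definitions using (Injective)

record Graph : Set where
  field
    n     : ℕ
    adj   : Fin n → Fin n → Bool
    sym   : ∀ i j → adj i j ≡ adj j i
    irrfl : ∀ i → adj i i ≡ false
open Graph public

data Reach {n : ℕ} (a : Fin n → Fin n → Bool) : Fin n → Fin n → Set where
  here : ∀ {i} → Reach a i i
  step : ∀ {i k j} → a i k ≡ true → Reach a k j → Reach a i j

ConnectedAdj : (n : ℕ) → (Fin n → Fin n → Bool) → Set
ConnectedAdj n a = (1 ≤ n) × (∀ i j → Reach a i j)

Connected : Graph → Set
Connected G = ConnectedAdj (n G) (adj G)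

InducedSubgraph : Graph → Graph → Set
InducedSubgraph S G =
  Σ (Fin (n S) → Fin (n G)) λ f →
    Injective _≡_ _≡_ f × (∀ i j → adj S i j ≡ adj G (f i) (f j))

Free : Graph → Graph → Set
Free H G = ¬ InducedSubgraph H G

record EdgeSet (G : Graph) : Set where
  field
    mem    : Fin (n G) → Fin (n G) → Bool
    memSym : ∀ i j → mem i j ≡ mem j i
    memSub : ∀ i j → mem i j ≡ true → adj G i j ≡ true
open EdgeSet public

∑ : (m : ℕ) → (Fin m → ℕ) → ℕ
∑ zero    f = 0
∑ (suc m) f = f zero + ∑ m (λ i → f (suc i))

size : {G : Graph} → EdgeSet G → ℕ
size {G} F = ∑ (n G) λ i → ∑ (n G) λ j →
  if (mem F i j ∧ (toℕ i <ᵇ toℕ j)) then 1 else 0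

IsEdgeCut : (G : Graph) → EdgeSet G → Set
IsEdgeCut G F = ¬ ConnectedAdj (n G) (λ i j → adj G i j ∧ not (mem F i j))

IsMinEdgeCut : (G : Graph) → EdgeSet G → Set
IsMinEdgeCut G F = IsEdgeCut G F × (∀ F' → IsEdgeCut G F' → size F ≤ size F')

IsolatesVertex : (G : Graph) → EdgeSet G → Fin (n G) → Set
IsolatesVertex G F v = ∀ i j →
  (mem F i j ≡ true → adj G i j ≡ true × (i ≡ v ⊎ j ≡ v)) ×
  (adj G i j ≡ true × (i ≡ v ⊎ j ≡ v) → mem F i j ≡ true)

SuperEdgeConnected : Graph → Set
SuperEdgeConnected G =
  Connected G × (∀ F → IsMinEdgeCut G F → ∃ λ v → IsolatesVertex G F v)

p3adj : Fin 3 → Fin 3 → Bool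
p3adj zero (suc zero) = true
p3adj (suc zero) zero = true
p3adj (suc zero) (suc (suc zero)) = true
p3adj (suc (suc zero)) (suc zero) = true
p3adj _ _ = false

P3 : Graph
P3 = record { n = 3 ; adj = p3adj ; sym = s ; irrfl = r }
  where
  open import Relation.Binary.PropositionalEquality using (refl)
  s : ∀ i j → p3adj i j ≡ p3adj j i
  s zero zero = refl
  s zero (suc zero) = refl
  s zero (suc (suc zero)) = refl
  s (suc zero) zero = refl
  s (suc zero) (suc zero) = refl
  s (suc zero) (suc (suc zero)) = refl
  s (suc (suc zero)) zero = refl
  s (suc (suc zero)) (suc zero) = refl
  s (suc (suc zero)) (suc (suc zero)) = refl
  r : ∀ i → p3adj i i ≡ false
  r zero = refl
  r (suc zero) = refl
  r (suc (suc zero)) = refl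

-- If S is induced in P3, an S-free graph is P3-free, so a connected one is complete. In a complete
-- graph, a cut separating i from j contains ij and, for every other vertex k, one of ik and jk: these
-- already pay for all edges of the star of i, so a minimum cut with any further edge would be too big.
-- Conversely, P4 cut at its middle edge, and the bowtie (two triangles sharing a vertex) cut at the
-- two edges of one triangle at the shared vertex, are connected graphs with a minimum edge cut that
-- isolates no vertex. Hence S is induced in both; as P4 is not induced in the bowtie, S has at most
-- three vertices, and as P4 has no triangle, the connected graph S is K1, K2 or P3.
module Submission where

open import Defs hiding (sym)
open import Data.Bool using (Bool; true; false; _∧_; _∨_; not; _xor_; if_then_else_)
open import Data.Bool.Properties
  using (∨-comm; ∨-zeroʳ; ∨-identityʳ; xor-comm; not-injective; ¬-not; not-¬; T-≡)
  renaming (_≟_ to _≟ᵇ_)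
open import Data.Empty using (⊥; ⊥-elim)
open import Data.Fin using (Fin; zero; suc; toℕ; punchOut; inject₁)
open import Data.Fin.Patterns using (0F; 1F; 2F; 3F; 4F)
open import Data.Fin.Properties
  using (_≟_; any?; all?; injective⇒≤; punchOut-injective; toℕ-injective; inject₁-injective)
open import Data.Nat using (ℕ; zero; suc; _+_; _≤_; _<_; _<ᵇ_; _≤?_; z≤n; s≤s)
open import Data.Nat.Properties
  using ( ≤-refl; ≤-trans; <⇒≱; ≤⇒≯; ≰⇒>; <-cmp; <⇒<ᵇ; <ᵇ⇒<; m≤m+n; +-identityʳ
        ; +-mono-≤; +-mono-<-≤; +-mono-≤-<; +-commutativeSemigroup; module ≤-Reasoning)
open import Algebra.Properties.CommutativeSemigroup +-commutativeSemigroup using (interchange)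
open import Data.Product using (∃; ∃₂; _×_; _,_; proj₁; proj₂; uncurry)
open import Data.Sum using (_⊎_; inj₁; inj₂; [_,_]′)
open import Function using (_∘_; id)
open import Function.Bundles using (Equivalence)
open import Function.Definitions using (Injective)
open import Relation.Binary using (tri<; tri≈; tri>)
open import Relation.Binary.PropositionalEquality
  using (_≡_; _≢_; refl; sym; trans; cong; cong₂; subst; module ≡-Reasoning)
open import Relation.Nullary using (¬_; yes; no; does; contradiction)
open import Relation.Nullary.Decidable
  using (dec-true; dec-false; from-yes; decidable-stable; _→-dec_; _×-dec_)

private
  variable
    m : ℕ

BRel : ℕ → Set
BRel m = Fin m → Fin m → Bool

Symmetric : BRel m → Set
Symmetric r = ∀ i j → r i j ≡ r j i

_⊆_ : BRel m → BRel m → Set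
r ⊆ s = ∀ i j → r i j ≡ true → s i j ≡ true

_∪_ _∩_ _∖_ : BRel m → BRel m → BRel m
(r ∪ s) i j = r i j ∨ s i j
(r ∩ s) i j = r i j ∧ s i j
(r ∖ s) i j = r i j ∧ not (s i j)

∪-sym : {r s : BRel m} → Symmetric r → Symmetric s → Symmetric (r ∪ s)
∪-sym r-sym s-sym i j = cong₂ _∨_ (r-sym i j) (s-sym i j)

∪-⊆ : {r s t : BRel m} → r ⊆ t → s ⊆ t → (r ∪ s) ⊆ t
∪-⊆ {r = r} r⊆t s⊆t i j e = [ r⊆t i j , s⊆t i j ]′ (∨-elim {r i j} e)
  where
  ∨-elim : ∀ {a b} → a ∨ b ≡ true → a ≡ true ⊎ b ≡ true
  ∨-elim {true}  _ = inj₁ refl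
  ∨-elim {false} e = inj₂ e

∖-antitone : ∀ (a : BRel m) {r s} → r ⊆ s → (a ∖ s) ⊆ (a ∖ r)
∖-antitone a {r} {s} r⊆s i j e with a i j | r i j in rij | s i j in sij
... | false | _     | _     = e
... | true  | false | _     = refl
... | true  | true  | true  = e
... | true  | true  | false = contradiction (trans (sym (r⊆s i j rij)) sij) λ ()

true-or-false : ∀ b → b ≡ true ⊎ b ≡ false
true-or-false true  = inj₁ refl
true-or-false false = inj₂ refl

∧-elim : ∀ {a b} → a ∧ b ≡ true → a ≡ true × b ≡ true
∧-elim {true} e = refl , e

∧-not-elim : ∀ {a b} → a ∧ not b ≡ true → a ≡ true × b ≡ false
∧-not-elim {true} {false} _ = refl , refl

is : Fin m → Fin m → Bool
is j i = does (i ≟ j)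

is-refl : (i : Fin m) → is i i ≡ true
is-refl i = dec-true (i ≟ i) refl

is⇒≡ : {i j : Fin m} → is j i ≡ true → i ≡ j
is⇒≡ {i = i} {j} e with i ≟ j
... | yes i≡j = i≡j

find : (P : Fin m → Bool) → (∃ λ i → P i ≡ true) ⊎ (∀ i → P i ≡ false)
find P with any? (λ i → P i ≟ᵇ true)
... | yes found = inj₁ found
... | no  none  = inj₂ λ i → ¬-not λ Pi → none (i , Pi)

finite-choice : {A : Fin m → Set} {B : Set} → (∀ i → A i ⊎ B) → (∀ i → A i) ⊎ B
finite-choice {zero}  h = inj₁ λ ()
finite-choice {suc m} h with h zero | finite-choice (h ∘ suc)
... | inj₂ b | _      = inj₂ b
... | inj₁ _ | inj₂ b = inj₂ b
... | inj₁ a | inj₁ f = inj₁ λ { zero → a ; (suc i) → f i }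

-- Walks

edge : {a : BRel m} → ∀ {u v} → a u v ≡ true → Reach a u v
edge e = step e here

Reach-++ : {a : BRel m} → ∀ {i j k} → Reach a i j → Reach a j k → Reach a i k
Reach-++ here       q = q
Reach-++ (step e p) q = step e (Reach-++ p q)

Reach-map : {a b : BRel m} → (∀ {u v} → a u v ≡ true → Reach b u v) →
            ∀ {i j} → Reach a i j → Reach b i j
Reach-map f here       = here
Reach-map f (step e p) = Reach-++ (f e) (Reach-map f p)

Reach-mono : {a b : BRel m} → a ⊆ b → ∀ {i j} → Reach a i j → Reach b i j
Reach-mono a⊆b = Reach-map λ {u} {v} e → edge (a⊆b u v e)

Reach-sym : {a : BRel m} → Symmetric a → ∀ {i j} → Reach a i j → Reach a j i
Reach-sym a-sym here               = here
Reach-sym a-sym (step {i} {k} e p) = Reach-++ (Reach-sym a-sym p) (edge (trans (a-sym k i) e))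

Reach-closed : {a : BRel m} (C : Fin m → Bool) →
               (∀ {u v} → C u ≡ true → a u v ≡ true → C v ≡ true) →
               ∀ {i j} → Reach a i j → C i ≡ true → C j ≡ true
Reach-closed C closed here       Ci = Ci
Reach-closed C closed (step e p) Ci = Reach-closed C closed p (closed Ci e)

connected-from-root : {a : BRel m} → Symmetric a → (r : Fin m) → (∀ i → Reach a r i) →
                      ∀ i j → Reach a i j
connected-from-root a-sym r reach i j = Reach-++ (Reach-sym a-sym (reach i)) (reach j)

-- Induced subgraphs

induced-trans : ∀ {A B C} → InducedSubgraph A B → InducedSubgraph B C → InducedSubgraph A C
induced-trans (f , f-inj , f-adj) (g , g-inj , g-adj) =
  g ∘ f , f-inj ∘ g-inj , λ x y → trans (f-adj x y) (g-adj (f x) (f y))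

injective⇒surjective : ∀ {m n} {f : Fin m → Fin n} → Injective _≡_ _≡_ f → n ≤ m →
                       ∀ y → ∃ λ x → f x ≡ y
injective⇒surjective {n = suc k} {f} f-inj n≤m y with any? (λ x → f x ≟ y)
... | yes hit  = hit
... | no  miss = contradiction n≤m (≤⇒≯ (injective⇒≤ g-inj))
  where
  y≢f : ∀ x → y ≢ f x
  y≢f x y≡fx = miss (x , sym y≡fx)
  g : Fin _ → Fin k
  g x = punchOut (y≢f x)
  g-inj : Injective _≡_ _≡_ g
  g-inj = f-inj ∘ punchOut-injective (y≢f _) (y≢f _)

induced-invert : ∀ {S H} → InducedSubgraph S H → n H ≤ n S → InducedSubgraph H S
induced-invert {S} {H} (f , f-inj , f-adj) n≤ = g , g-inj , g-adj
  where
  open ≡-Reasoning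
  g : Fin (n H) → Fin (n S)
  g y = proj₁ (injective⇒surjective f-inj n≤ y)
  f∘g : ∀ y → f (g y) ≡ y
  f∘g y = proj₂ (injective⇒surjective f-inj n≤ y)
  g-inj : Injective _≡_ _≡_ g
  g-inj {y} {y′} gy≡gy′ = trans (sym (f∘g y)) (trans (cong f gy≡gy′) (f∘g y′))
  g-adj : ∀ y y′ → adj H y y′ ≡ adj S (g y) (g y′)
  g-adj y y′ = begin
    adj H y y′                 ≡⟨ sym (cong₂ (adj H) (f∘g y) (f∘g y′)) ⟩
    adj H (f (g y)) (f (g y′)) ≡⟨ sym (f-adj (g y) (g y′)) ⟩
    adj S (g y) (g y′)         ∎

adjacent⇒distinct : ∀ (G : Graph) {i j} → adj G i j ≡ true → i ≢ j
adjacent⇒distinct G {i} e refl with () ← trans (sym e) (irrfl G i)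

inducedP3 : ∀ (G : Graph) {u v w} → adj G u v ≡ true → adj G v w ≡ true → adj G u w ≡ false →
            u ≢ w →            InducedSubgraph P3 G
inducedP3 G {u} {v} {w} uv vw uw u≢w = g , g-inj , g-adj
  where
  u≢v = adjacent⇒distinct G uv
  v≢w = adjacent⇒distinct G vw
  g : Fin 3 → Fin (n G)
  g 0F = u
  g 1F = v
  g 2F = w
  g-inj : Injective _≡_ _≡_ g
  g-inj {0F} {0F} _ = refl
  g-inj {1F} {1F} _ = refl
  g-inj {2F} {2F} _ = refl
  g-inj {0F} {1F} e = contradiction e u≢v
  g-inj {0F} {2F} e = contradiction e u≢w
  g-inj {1F} {0F} e = contradiction (sym e) u≢v
  g-inj {1F} {2F} e = contradiction e v≢w
  g-inj {2F} {0F} e = contradiction (sym e) u≢w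
  g-inj {2F} {1F} e = contradiction (sym e) v≢w
  g-adj : ∀ x y → p3adj x y ≡ adj G (g x) (g y)
  g-adj 0F 0F = sym (irrfl G u)
  g-adj 1F 1F = sym (irrfl G v)
  g-adj 2F 2F = sym (irrfl G w)
  g-adj 0F 1F = sym uv
  g-adj 1F 2F = sym vw
  g-adj 0F 2F = sym uw
  g-adj 1F 0F = sym (trans (Graph.sym G v u) uv)
  g-adj 2F 1F = sym (trans (Graph.sym G w v) vw)
  g-adj 2F 0F = sym (trans (Graph.sym G w u) uw)

adjacent-or-inducedP3 : ∀ (G : Graph) {i j} → Reach (adj G) i j → i ≢ j →
                        adj G i j ≡ true ⊎ InducedSubgraph P3 G
adjacent-or-inducedP3 G here i≢j = contradiction refl i≢j
adjacent-or-inducedP3 G {i} {j} (step {k = k} ik kj) i≢j with k ≟ j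
... | yes refl = inj₁ ik
... | no  k≢j with adjacent-or-inducedP3 G kj k≢j
...   | inj₂ P3⊆G = inj₂ P3⊆G
...   | inj₁ k~j with adj G i j in ij
...     | true  = inj₁ refl
...     | false = inj₂ (inducedP3 G ik k~j ij i≢j)

P3-free⇒complete : ∀ (G : Graph) → Connected G → Free P3 G → ∀ {i j} → i ≢ j → adj G i j ≡ true
P3-free⇒complete G (_ , reach) P3-free {i} {j} i≢j with adjacent-or-inducedP3 G (reach i j) i≢j
... | inj₁ ij   = ij
... | inj₂ P3⊆G = contradiction P3⊆G P3-free

-- Counting edges

[_] : Bool → ℕ
[ b ] = if b then 1 else 0

_<ᶠ_ : Fin m → Fin m → Bool
i <ᶠ j = toℕ i <ᵇ toℕ j

-- Each unordered pair is counted once, from its smaller end, so that size F is pairs (mem F).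
pairs : BRel m → ℕ
pairs {m} r = ∑ m λ i → ∑ m λ j → [ r i j ∧ i <ᶠ j ]

count : (Fin m → Bool) → ℕ
count {m} P = ∑ m λ j → [ P j ]

∑-cong : ∀ m {f g : Fin m → ℕ} → (∀ i → f i ≡ g i) → ∑ m f ≡ ∑ m g
∑-cong zero    _ = refl
∑-cong (suc m) h = cong₂ _+_ (h zero) (∑-cong m (h ∘ suc))

∑-mono-≤ : ∀ m {f g : Fin m → ℕ} → (∀ i → f i ≤ g i) → ∑ m f ≤ ∑ m g
∑-mono-≤ zero    _ = z≤n
∑-mono-≤ (suc m) h = +-mono-≤ (h zero) (∑-mono-≤ m (h ∘ suc))

∑-mono-< : ∀ m {f g : Fin m → ℕ} → (∀ i → f i ≤ g i) → ∀ k → f k < g k → ∑ m f < ∑ m g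
∑-mono-< (suc m) h zero    fk<gk = +-mono-<-≤ fk<gk (∑-mono-≤ m (h ∘ suc))
∑-mono-< (suc m) h (suc k) fk<gk = +-mono-≤-< (h zero) (∑-mono-< m (h ∘ suc) k fk<gk)

∑-distrib-+ : ∀ m (f g : Fin m → ℕ) → ∑ m (λ i → f i + g i) ≡ ∑ m f + ∑ m g
∑-distrib-+ zero    f g = refl
∑-distrib-+ (suc m) f g =
  trans (cong (f zero + g zero +_) (∑-distrib-+ m (f ∘ suc) (g ∘ suc)))
        (interchange (f zero) (g zero) (∑ m (f ∘ suc)) (∑ m (g ∘ suc)))

∑-zero : ∀ m → ∑ m (λ _ → 0) ≡ 0
∑-zero zero    = refl
∑-zero (suc m) = ∑-zero m

∑-if : ∀ m b (f : Fin m → ℕ) → ∑ m (λ i → if b then f i else 0) ≡ (if b then ∑ m f else 0)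
∑-if m true  f = refl
∑-if m false f = ∑-zero m

∑-δ : ∀ m (c : Fin m) x → ∑ m (λ i → if is c i then x else 0) ≡ x
∑-δ (suc m) zero    x = trans (cong (x +_) (∑-zero m)) (+-identityʳ x)
∑-δ (suc m) (suc c) x = ∑-δ m c x

<ᵇ-true : ∀ {x y} → x < y → (x <ᵇ y) ≡ true
<ᵇ-true x<y = Equivalence.to T-≡ (<⇒<ᵇ x<y)

<ᵇ-false : ∀ {x y} → ¬ x < y → (x <ᵇ y) ≡ false
<ᵇ-false {x} {y} x≮y = ¬-not λ e → x≮y (<ᵇ⇒< x y (Equivalence.from T-≡ e))

<ᶠ-trichotomy : {i j : Fin m} → i ≢ j → [ i <ᶠ j ] + [ j <ᶠ i ] ≡ 1
<ᶠ-trichotomy {i = i} {j} i≢j with <-cmp (toℕ i) (toℕ j)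
... | tri< i<j _ j≮i = cong₂ (λ a b → [ a ] + [ b ]) (<ᵇ-true i<j) (<ᵇ-false j≮i)
... | tri≈ _ i≡j _   = contradiction (toℕ-injective i≡j) i≢j
... | tri> i≮j _ j<i = cong₂ (λ a b → [ a ] + [ b ]) (<ᵇ-false i≮j) (<ᵇ-true j<i)

module _ {r s : BRel m} where

  private
    [∧]-mono : ∀ {a b} l → (a ≡ true → b ≡ true) → [ a ∧ l ] ≤ [ b ∧ l ]
    [∧]-mono {false} l _ = z≤n
    [∧]-mono {true}  l h rewrite h refl = ≤-refl

    pairs-mono-<-ordered : r ⊆ s → ∀ {p q} → s p q ≡ true → r p q ≡ false → (p <ᶠ q) ≡ true →
                           pairs r < pairs s
    pairs-mono-<-ordered r⊆s {p} {q} spq rpq p<q =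
      ∑-mono-< m (λ i → ∑-mono-≤ m λ j → [∧]-mono (i <ᶠ j) (r⊆s i j)) p
        (∑-mono-< m (λ j → [∧]-mono (p <ᶠ j) (r⊆s p j)) q strict)
      where
      strict : [ r p q ∧ p <ᶠ q ] < [ s p q ∧ p <ᶠ q ]
      strict rewrite spq | rpq | p<q = s≤s z≤n

  pairs-mono : r ⊆ s → pairs r ≤ pairs s
  pairs-mono r⊆s = ∑-mono-≤ m λ i → ∑-mono-≤ m λ j → [∧]-mono (i <ᶠ j) (r⊆s i j)

  pairs-mono-< : r ⊆ s → Symmetric r → Symmetric s → ∀ {p q} → p ≢ q →
                 s p q ≡ true → r p q ≡ false → pairs r < pairs s
  pairs-mono-< r⊆s r-sym s-sym {p} {q} p≢q spq rpq with <-cmp (toℕ p) (toℕ q)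
  ... | tri< p<q _ _ = pairs-mono-<-ordered r⊆s spq rpq (<ᵇ-true p<q)
  ... | tri≈ _ p≡q _ = contradiction (toℕ-injective p≡q) p≢q
  ... | tri> _ _ q<p =
    pairs-mono-<-ordered r⊆s (trans (s-sym q p) spq) (trans (r-sym q p) rpq) (<ᵇ-true q<p)

  pairs-∪-∩ : pairs (r ∪ s) + pairs (r ∩ s) ≡ pairs r + pairs s
  pairs-∪-∩ =
    trans (sym (pairs-+ (r ∪ s) (r ∩ s)))
          (trans (∑-cong m λ i → ∑-cong m λ j → incl-excl (r i j) (s i j) (i <ᶠ j)) (pairs-+ r s))
    where
    pairs-+ : ∀ r s → ∑ m (λ i → ∑ m λ j → [ r i j ∧ i <ᶠ j ] + [ s i j ∧ i <ᶠ j ]) ≡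
                      pairs r + pairs s
    pairs-+ r s = trans (∑-cong m λ i → ∑-distrib-+ m _ _) (∑-distrib-+ m _ _)
    incl-excl : ∀ a b l → [ (a ∨ b) ∧ l ] + [ (a ∧ b) ∧ l ] ≡ [ a ∧ l ] + [ b ∧ l ]
    incl-excl true  true  l     = refl
    incl-excl true  false l     = refl
    incl-excl false true  true  = refl
    incl-excl false true  false = refl
    incl-excl false false l     = refl

pairs-empty : {r : BRel m} → (∀ i j → r i j ≡ false) → pairs r ≡ 0
pairs-empty {m} none =
  trans (∑-cong m λ i → trans (∑-cong m λ j → cong (λ b → [ b ∧ i <ᶠ j ]) (none i j)) (∑-zero m))
        (∑-zero m)

pairs-pos : {s : BRel m} → Symmetric s → ∀ {p q} → p ≢ q → s p q ≡ true → 1 ≤ pairs s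
pairs-pos s-sym p≢q spq =
  ≤-trans (s≤s z≤n) (pairs-mono-< (λ _ _ ()) (λ _ _ → refl) s-sym p≢q spq refl)

module _ {r s : BRel m} where

  pairs-∪ : pairs (r ∪ s) ≤ pairs r + pairs s
  pairs-∪ = subst (pairs (r ∪ s) ≤_) (pairs-∪-∩ {r = r} {s = s}) (m≤m+n _ _)

  pairs-∪-disjoint : (∀ i j → (r ∩ s) i j ≡ false) → pairs (r ∪ s) ≡ pairs r + pairs s
  pairs-∪-disjoint disjoint = begin
    pairs (r ∪ s)                 ≡⟨ sym (+-identityʳ _) ⟩
    pairs (r ∪ s) + 0             ≡⟨ cong (pairs (r ∪ s) +_) (sym (pairs-empty disjoint)) ⟩
    pairs (r ∪ s) + pairs (r ∩ s) ≡⟨ pairs-∪-∩ {r = r} {s = s} ⟩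
    pairs r + pairs s             ∎
    where open ≡-Reasoning

-- Stars

star : Fin m → (Fin m → Bool) → BRel m
star c P i j = (is c i ∧ P j) ∨ (is c j ∧ P i)

star-sym : ∀ (c : Fin m) P → Symmetric (star c P)
star-sym c P i j = ∨-comm (is c i ∧ P j) (is c j ∧ P i)

star-introˡ : ∀ (c : Fin m) P j → P j ≡ true → star c P c j ≡ true
star-introˡ c P j Pj rewrite is-refl c | Pj = refl

star-elim : ∀ (c : Fin m) P {i j} → star c P i j ≡ true →
            (i ≡ c × P j ≡ true) ⊎ (j ≡ c × P i ≡ true)
star-elim c P {i} {j} e with is c i in ci | P j in Pj | is c j in cj | P i in Pi
... | true  | true  | _     | _     = inj₁ (is⇒≡ ci , refl)
... | _     | _     | true  | true  = inj₂ (is⇒≡ cj , refl)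
... | false | _     | false | _     = contradiction e λ ()
... | false | _     | true  | false = contradiction e λ ()
... | true  | false | false | _     = contradiction e λ ()
... | true  | false | true  | false = contradiction e λ ()

star-avoids : ∀ {c k k′ : Fin m} P → k ≢ c → k′ ≢ c → star c P k k′ ≡ false
star-avoids {c = c} {k} {k′} P k≢c k′≢c
  rewrite dec-false (k ≟ c) k≢c | dec-false (k′ ≟ c) k′≢c = refl

star⊆ : ∀ {c : Fin m} {P R} → Symmetric R → (∀ q → P q ≡ true → R c q ≡ true) → star c P ⊆ R
star⊆ {c = c} {P} R-sym row i j e with star-elim c P {i} {j} e
... | inj₁ (refl , Pj) = row j Pj
... | inj₂ (refl , Pi) = trans (R-sym i c) (row i Pi)

star-split : ∀ (c : Fin m) {P Q R} → (∀ q → P q ≡ true → Q q ≡ true ⊎ R q ≡ true) →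
             star c P ⊆ (star c Q ∪ star c R)
star-split c {P} {Q} {R} split = star⊆ (∪-sym (star-sym c Q) (star-sym c R)) row
  where
  row : ∀ q → P q ≡ true → (star c Q ∪ star c R) c q ≡ true
  row q Pq with split q Pq
  ... | inj₁ Qq rewrite star-introˡ c Q q Qq = refl
  ... | inj₂ Rq rewrite star-introˡ c R q Rq = ∨-zeroʳ _

star-disjoint : ∀ {i j : Fin m} {P Q} → i ≢ j → Q i ≡ false →
                ∀ x y → (star i P ∩ star j Q) x y ≡ false
star-disjoint {i = i} {j} {P} {Q} i≢j Qi x y = ¬-not λ e →
  clash (star-elim i P {x} {y} (proj₁ (∧-elim {star i P x y} e)))
        (star-elim j Q {x} {y} (proj₂ (∧-elim {star i P x y} e)))
  where
  clash : (x ≡ i × P y ≡ true) ⊎ (y ≡ i × P x ≡ true) →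
          (x ≡ j × Q y ≡ true) ⊎ (y ≡ j × Q x ≡ true) → ⊥
  clash (inj₁ (refl , _)) (inj₁ (x≡j , _)) = i≢j x≡j
  clash (inj₁ (refl , _)) (inj₂ (_ , Qx))  = not-¬ Qx Qi
  clash (inj₂ (refl , _)) (inj₁ (_ , Qy))  = not-¬ Qy Qi
  clash (inj₂ (refl , _)) (inj₂ (y≡j , _)) = i≢j y≡j

star-is-determined : ∀ (p q : Fin m) u v w →
                     star p (is q) u v ≡ true → star p (is q) u w ≡ true → v ≡ w
star-is-determined p q u v w euv euw with star-elim p (is q) {u} {v} euv | star-elim p (is q) {u} {w} euw
... | inj₁ (refl , v≡q) | inj₁ (_ , w≡q)   = trans (is⇒≡ v≡q) (sym (is⇒≡ w≡q))
... | inj₁ (refl , v≡q) | inj₂ (w≡p , p≡q) = trans (is⇒≡ v≡q) (trans (sym (is⇒≡ p≡q)) (sym w≡p))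
... | inj₂ (v≡p , u≡q)  | inj₁ (u≡p , w≡q) =
  trans v≡p (trans (sym u≡p) (trans (is⇒≡ u≡q) (sym (is⇒≡ w≡q))))
... | inj₂ (v≡p , _)    | inj₂ (w≡p , _)   = trans v≡p (sym w≡p)

module _ {c : Fin m} {P : Fin m → Bool} (Pc : P c ≡ false) where

  private
    above below : Fin m → ℕ
    above j = [ P j ∧ c <ᶠ j ]
    below i = [ P i ∧ i <ᶠ c ]

    δ : Fin m → ℕ → ℕ
    δ i x = if is c i then x else 0

    star-term : ∀ i j → [ star c P i j ∧ i <ᶠ j ] ≡ δ i (above j) + δ j (below i)
    star-term i j with i ≟ c | j ≟ c
    ... | yes refl | yes refl rewrite Pc = refl
    ... | yes refl | no  _    rewrite ∨-identityʳ (P j) = sym (+-identityʳ _)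
    ... | no  _    | yes refl = refl
    ... | no  _    | no  _    = refl

    split-at-c : ∀ j → above j + below j ≡ [ P j ]
    split-at-c j with j ≟ c | P j in Pj
    ... | yes refl | true  = contradiction (trans (sym Pj) Pc) λ ()
    ... | yes refl | false = refl
    ... | no  j≢c  | true  = <ᶠ-trichotomy (j≢c ∘ sym)
    ... | no  _    | false = refl

  pairs-star : pairs (star c P) ≡ count P
  pairs-star = begin
    pairs (star c P)
      ≡⟨ ∑-cong m (λ i → ∑-cong m (star-term i)) ⟩
    ∑ m (λ i → ∑ m λ j → δ i (above j) + δ j (below i))
      ≡⟨ ∑-cong m (λ i → ∑-distrib-+ m _ _) ⟩
    ∑ m (λ i → ∑ m (λ j → δ i (above j)) + ∑ m (λ j → δ j (below i)))
      ≡⟨ ∑-cong m (λ i → cong₂ _+_ (∑-if m (is c i) above) (∑-δ m c (below i))) ⟩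
    ∑ m (λ i → δ i (∑ m above) + below i)
      ≡⟨ ∑-distrib-+ m _ _ ⟩
    ∑ m (λ i → δ i (∑ m above)) + ∑ m below
      ≡⟨ cong (_+ ∑ m below) (∑-δ m c _) ⟩
    ∑ m above + ∑ m below
      ≡⟨ sym (∑-distrib-+ m above below) ⟩
    ∑ m (λ j → above j + below j)
      ≡⟨ ∑-cong m split-at-c ⟩
    count P
      ∎
    where open ≡-Reasoning

-- Edge cuts

_─_ : (G : Graph) → EdgeSet G → BRel (n G)
G ─ F = adj G ∖ mem F

─-sym : ∀ (G : Graph) (F : EdgeSet G) → Symmetric (G ─ F)
─-sym G F i j = cong₂ (λ a b → a ∧ not b) (Graph.sym G i j) (memSym F i j)

blocked : ∀ (G : Graph) (F : EdgeSet G) {u v} → adj G u v ≡ true → (G ─ F) u v ≡ false →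
          mem F u v ≡ true
blocked G F uv e = not-injective (trans (cong (_∧ _) (sym uv)) e)

∂ : (G : Graph) → (Fin (n G) → Bool) → EdgeSet G
∂ G C = record
  { mem    = λ i j → adj G i j ∧ (C i xor C j)
  ; memSym = λ i j → cong₂ _∧_ (Graph.sym G i j) (xor-comm (C i) (C j))
  ; memSub = λ i j → proj₁ ∘ ∧-elim
  }

vertexStar : (G : Graph) → Fin (n G) → EdgeSet G
vertexStar G v = record
  { mem    = star v (adj G v)
  ; memSym = star-sym v (adj G v)
  ; memSub = star⊆ (Graph.sym G) λ _ → id
  }

isEdgeCut-of-closed : ∀ (G : Graph) (F : EdgeSet G) (C : Fin (n G) → Bool) {i j} →
                      C i ≡ true → C j ≡ false →
                      (∀ {u v} → C u ≡ true → (G ─ F) u v ≡ true → C v ≡ true) → IsEdgeCut G F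
isEdgeCut-of-closed G F C {i} {j} Ci Cj closed (_ , reach) =
  not-¬ (Reach-closed C closed (reach i j) Ci) Cj

∂-isEdgeCut : ∀ (G : Graph) (C : Fin (n G) → Bool) {i j} → C i ≡ true → C j ≡ false →
              IsEdgeCut G (∂ G C)
∂-isEdgeCut G C Ci Cj = isEdgeCut-of-closed G (∂ G C) C Ci Cj closed
  where
  stays : ∀ a c → a ∧ not (a ∧ (true xor c)) ≡ true → c ≡ true
  stays true true _ = refl
  closed : ∀ {u v} → C u ≡ true → (G ─ ∂ G C) u v ≡ true → C v ≡ true
  closed {u} {v} Cu e rewrite Cu = stays (adj G u v) (C v) e

vertexStar-isEdgeCut : ∀ (G : Graph) {v w} → w ≢ v → IsEdgeCut G (vertexStar G v)
vertexStar-isEdgeCut G {v} {w} w≢v =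
  isEdgeCut-of-closed G (vertexStar G v) (is v) {v} {w} (is-refl v) (dec-false (w ≟ v) w≢v) nothing-leaves
  where
  nothing-leaves : ∀ {u x} → is v u ≡ true → (G ─ vertexStar G v) u x ≡ true → is v x ≡ true
  nothing-leaves {u} {x} u≡v e with refl ← is⇒≡ {i = u} {v} u≡v = let (vx , ∌vx) = ∧-not-elim e in
    ⊥-elim (not-¬ (star-introˡ v (adj G v) x vx) ∌vx)

Triangulated : Graph → Set
Triangulated G = ∀ {u v} → adj G u v ≡ true → ∃ λ w → adj G u w ≡ true × adj G w v ≡ true

-- The triangle on an edge lets a walk bypass it when that single edge is removed.
triangle-detour : ∀ (G : Graph) → Triangulated G → ∀ p q {u v} → adj G u v ≡ true →
                  Reach (adj G ∖ star p (is q)) u v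
triangle-detour G triangulated p q {u} {v} uv with true-or-false (star p (is q) u v)
... | inj₂ ∌uv = edge (cong₂ (λ a b → a ∧ not b) uv ∌uv)
... | inj₁ ∋uv with w , uw , wv ← triangulated uv =
  step (keep uw λ ∋uw → adjacent⇒distinct G wv (star-is-determined p q u w v ∋uw ∋uv))
       (edge (keep wv λ ∋wv → adjacent⇒distinct G uw
                (star-is-determined p q v u w (flip v u ∋uv) (flip v w ∋wv))))
  where
  keep : ∀ {x y} → adj G x y ≡ true → star p (is q) x y ≢ true → (adj G ∖ star p (is q)) x y ≡ true
  keep xy ∌xy = cong₂ (λ a b → a ∧ not b) xy (¬-not ∌xy)
  flip : ∀ x y → star p (is q) y x ≡ true → star p (is q) x y ≡ true
  flip x y = trans (star-sym p (is q) x y)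

module _ (G : Graph) (G-conn : Connected G) {F : EdgeSet G} (F-cut : IsEdgeCut G F) where

  cut-has-edge : ∃₂ λ p q → mem F p q ≡ true
  cut-has-edge with any? (λ p → any? λ q → mem F p q ≟ᵇ true)
  ... | yes found = found
  ... | no  none  =
    contradiction (proj₁ G-conn , λ i j → Reach-mono adj⊆G─F (proj₂ G-conn i j)) F-cut
    where
    adj⊆G─F : adj G ⊆ (G ─ F)
    adj⊆G─F u v uv = cong₂ (λ a b → a ∧ not b) uv (¬-not λ e → none (u , v , e))

  size-of-cut≥1 : 1 ≤ size F
  size-of-cut≥1 with p , q , pq ← cut-has-edge =
    pairs-pos (memSym F) (adjacent⇒distinct G (memSub F p q pq)) pq

  -- Either F has an edge besides pq, or G stays connected when only pq is removed.
  size-of-cut≥2 : Triangulated G → 2 ≤ size F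
  size-of-cut≥2 triangulated with p , q , pq ← cut-has-edge
    with any? (λ u → any? λ v → (mem F u v ∧ not (star p (is q) u v)) ≟ᵇ true)
  ... | yes (u , v , uv) =
    ≤-trans (s≤s (pairs-pos (star-sym p (is q)) p≢q (star-introˡ p (is q) q (is-refl q))))
            (pairs-mono-< pq⊆F (star-sym p (is q)) (memSym F) u≢v Fuv ∌uv)
    where
    Fuv = proj₁ (∧-not-elim uv)
    ∌uv = proj₂ (∧-not-elim uv)
    p≢q = adjacent⇒distinct G (memSub F p q pq)
    u≢v = adjacent⇒distinct G (memSub F u v Fuv)
    pq⊆F : star p (is q) ⊆ mem F
    pq⊆F = star⊆ (memSym F) λ j j≡q → subst (λ j → mem F p j ≡ true) (sym (is⇒≡ j≡q)) pq
  ... | no only-pq =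
    contradiction (proj₁ G-conn , λ i j → Reach-map bypass (proj₂ G-conn i j)) F-cut
    where
    F⊆pq : mem F ⊆ star p (is q)
    F⊆pq u v Fuv =
      ¬-not {y = false} λ ∌uv → only-pq (u , v , cong₂ (λ a b → a ∧ not b) Fuv ∌uv)
    bypass : ∀ {u v} → adj G u v ≡ true → Reach (G ─ F) u v
    bypass uv = Reach-mono (∖-antitone (adj G) F⊆pq) (triangle-detour G triangulated p q uv)

¬superEdgeConnected : ∀ (G : Graph) {F : EdgeSet G} → IsMinEdgeCut G F → ∀ {p q p′ q′} →
                      mem F p q ≡ true → adj G p p′ ≡ true → mem F p p′ ≡ false →
                      adj G q q′ ≡ true → mem F q q′ ≡ false → ¬ SuperEdgeConnected G
¬superEdgeConnected G {F} F-min {p} {q} {p′} {q′} pq pp′ F∌pp′ qq′ F∌qq′ (_ , sec)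
  with v , iso ← sec F F-min with proj₂ (proj₁ (iso p q) pq)
... | inj₁ refl = not-¬ (proj₂ (iso p p′) (pp′ , inj₁ refl)) F∌pp′
... | inj₂ refl = not-¬ (proj₂ (iso q q′) (qq′ , inj₁ refl)) F∌qq′

-- Complete graphs

module _ (G : Graph) (F : EdgeSet G) where

  contains-star⇒isolates : ∀ {v} → (∀ q → adj G v q ≡ true → mem F v q ≡ true) →
                           size F ≤ size (vertexStar G v) → IsolatesVertex G F v
  contains-star⇒isolates {v} F⊇star F≤star i j = incident , F⊇star′ i j
    where
    F⊇star′ : ∀ i j → adj G i j ≡ true × (i ≡ v ⊎ j ≡ v) → mem F i j ≡ true
    F⊇star′ i j (ij , inj₁ refl) = F⊇star j ij
    F⊇star′ i j (ij , inj₂ refl) = trans (memSym F i v) (F⊇star i (trans (Graph.sym G v i) ij))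
    incident : mem F i j ≡ true → adj G i j ≡ true × (i ≡ v ⊎ j ≡ v)
    incident Fij with i ≟ v | j ≟ v
    ... | yes i≡v | _       = memSub F i j Fij , inj₁ i≡v
    ... | no  _   | yes j≡v = memSub F i j Fij , inj₂ j≡v
    ... | no  i≢v | no  j≢v = contradiction F≤star (<⇒≱
      (pairs-mono-< (star⊆ (memSym F) F⊇star) (star-sym v (adj G v)) (memSym F)
                    (adjacent⇒distinct G (memSub F i j Fij)) Fij (star-avoids (adj G v) i≢v j≢v)))

  -- F pays for the star of i with the edges iq in F and the edges jq for the other neighbours q of i;
  -- the edge kk′ is not among them.
  size-vertexStar<size : ∀ {i j k k′} → i ≢ j →
                         (∀ q → adj G i q ≡ true → mem F i q ≡ false → mem F j q ≡ true) →
                         mem F k k′ ≡ true → k ≢ i → k ≢ j → k′ ≢ i → k′ ≢ j →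
                         size (vertexStar G i) < size F
  size-vertexStar<size {i} {j} {k} {k′} i≢j traded Fkk′ k≢i k≢j k′≢i k′≢j = begin-strict
    size (vertexStar G i)                    ≤⟨ pairs-mono (star-split i split) ⟩
    pairs (star i P₁ ∪ star i P₂)            ≤⟨ pairs-∪ {r = star i P₁} {s = star i P₂} ⟩
    pairs (star i P₁) + pairs (star i P₂)    ≡⟨ cong (pairs (star i P₁) +_) star-i≡star-j ⟩
    pairs (star i P₁) + pairs (star j P₂)    ≡⟨ sym (pairs-∪-disjoint (star-disjoint i≢j P₂i)) ⟩
    pairs (star i P₁ ∪ star j P₂)
      <⟨ pairs-mono-< ⊆F (∪-sym (star-sym i P₁) (star-sym j P₂)) (memSym F) k≢k′ Fkk′ ∌kk′ ⟩
    size F                                   ∎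
    where
    open ≤-Reasoning
    P₁ P₂ : Fin (n G) → Bool
    P₁ q = mem F i q
    P₂ q = adj G i q ∧ not (mem F i q)
    split : ∀ q → adj G i q ≡ true → P₁ q ≡ true ⊎ P₂ q ≡ true
    split q iq =
      [ inj₁ , (λ F∌iq → inj₂ (cong₂ (λ a b → a ∧ not b) iq F∌iq)) ]′ (true-or-false (mem F i q))
    P₂i : P₂ i ≡ false
    P₂i = cong (_∧ not (mem F i i)) (irrfl G i)
    P₂j : P₂ j ≡ false
    P₂j = ¬-not λ P₂j → adjacent⇒distinct G (memSub F j j (uncurry (traded j) (∧-not-elim P₂j))) refl
    star-i≡star-j : pairs (star i P₂) ≡ pairs (star j P₂)
    star-i≡star-j = trans (pairs-star {c = i} P₂i) (sym (pairs-star {c = j} P₂j))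
    ⊆F : (star i P₁ ∪ star j P₂) ⊆ mem F
    ⊆F = ∪-⊆ (star⊆ (memSym F) λ _ → id)
             (star⊆ (memSym F) λ q P₂q → uncurry (traded q) (∧-not-elim P₂q))
    k≢k′ = adjacent⇒distinct G (memSub F k k′ Fkk′)
    ∌kk′ : (star i P₁ ∪ star j P₂) k k′ ≡ false
    ∌kk′ = cong₂ _∨_ (star-avoids P₁ k≢i k′≢i) (star-avoids P₂ k≢j k′≢j)

module _ (G : Graph) (complete : ∀ {i j} → i ≢ j → adj G i j ≡ true)
         {F : EdgeSet G} (F-min : IsMinEdgeCut G F) where

  private
    no-bigger-than-star : ∀ {v w} → w ≢ v → size F ≤ size (vertexStar G v)
    no-bigger-than-star {v} w≢v = proj₂ F-min (vertexStar G v) (vertexStar-isEdgeCut G w≢v)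

    cut-off : ∀ {v w} → w ≢ v → (∀ q → (G ─ F) v q ≡ false) → IsolatesVertex G F v
    cut-off w≢v stuck =
      contains-star⇒isolates G F (λ q vq → blocked G F vq (stuck q)) (no-bigger-than-star w≢v)

    kept : ∀ {u v} → u ≢ v → mem F u v ≡ false → (G ─ F) u v ≡ true
    kept u≢v Fuv = cong₂ (λ a b → a ∧ not b) (complete u≢v) Fuv

    -- The walk i k k′ j, unless kk′ ∈ F makes F larger than the star of i.
    detour : ∀ {i j k k′} → i ≢ j → mem F i j ≡ true →
             (∀ q → ((G ─ F) i q ∧ (G ─ F) q j) ≡ false) →
             (G ─ F) i k ≡ true → (G ─ F) j k′ ≡ true → Reach (G ─ F) i j
    detour {i} {j} {k} {k′} i≢j Fij no-common ik jk′ =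
      [ (λ Fkk′ → contradiction (no-bigger-than-star (i≢j ∘ sym))
                    (<⇒≱ (size-vertexStar<size G F i≢j traded Fkk′ k≢i k≢j k′≢i k′≢j)))
      , (λ F∌kk′ → step ik (step (kept k≢k′ F∌kk′) (edge (trans (─-sym G F k′ j) jk′)))) ]′
      (true-or-false (mem F k k′))
      where
      traded : ∀ q → adj G i q ≡ true → mem F i q ≡ false → mem F j q ≡ true
      traded q iq F∌iq = trans (memSym F j q) (blocked G F (complete q≢j)
                           (trans (sym (cong (_∧ _) (kept (adjacent⇒distinct G iq) F∌iq))) (no-common q)))
        where
        q≢j : q ≢ j
        q≢j refl = not-¬ Fij F∌iq
      k≢i : k ≢ i
      k≢i = adjacent⇒distinct G (proj₁ (∧-not-elim ik)) ∘ sym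
      k′≢j : k′ ≢ j
      k′≢j = adjacent⇒distinct G (proj₁ (∧-not-elim jk′)) ∘ sym
      k≢j : k ≢ j
      k≢j refl = not-¬ Fij (proj₂ (∧-not-elim ik))
      k′≢i : k′ ≢ i
      k′≢i refl = not-¬ (trans (memSym F j i) Fij) (proj₂ (∧-not-elim jk′))
      k≢k′ : k ≢ k′
      k≢k′ refl = not-¬ (cong₂ _∧_ ik (trans (─-sym G F k j) jk′)) (no-common k)

  reach-or-isolated : ∀ i j → Reach (G ─ F) i j ⊎ ∃ (IsolatesVertex G F)
  reach-or-isolated i j with i ≟ j
  ... | yes refl = inj₁ here
  ... | no  i≢j with true-or-false (mem F i j)
  ...   | inj₂ F∌ij = inj₁ (edge (kept i≢j F∌ij))
  ...   | inj₁ Fij with find (λ k → (G ─ F) i k ∧ (G ─ F) k j)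
  ...     | inj₁ (k , ikj) = let (ik , kj) = ∧-elim {(G ─ F) i k} ikj in inj₁ (step ik (edge kj))
  ...     | inj₂ no-common with find ((G ─ F) i) | find ((G ─ F) j)
  ...       | inj₂ i-stuck  | _               = inj₂ (i , cut-off (i≢j ∘ sym) i-stuck)
  ...       | inj₁ _        | inj₂ j-stuck    = inj₂ (j , cut-off i≢j j-stuck)
  ...       | inj₁ (k , ik) | inj₁ (k′ , jk′) = inj₁ (detour i≢j Fij no-common ik jk′)

complete⇒superEdgeConnected : ∀ (G : Graph) → Connected G → (∀ {i j} → i ≢ j → adj G i j ≡ true) →
                              SuperEdgeConnected G
complete⇒superEdgeConnected G G-conn complete = G-conn , λ F F-min →
  [ (λ reach → contradiction (proj₁ G-conn , reach) (proj₁ F-min)) , id ]′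
  (finite-choice λ i → finite-choice {A = Reach (G ─ F) i} (reach-or-isolated G complete {F} F-min i))

-- Two graphs that are not super-edge-connected

p4adj : Fin 4 → Fin 4 → Bool
p4adj 0F 1F = true
p4adj 1F 0F = true
p4adj 1F 2F = true
p4adj 2F 1F = true
p4adj 2F 3F = true
p4adj 3F 2F = true
p4adj _  _  = false

P4 : Graph
P4 = record
  { n     = 4
  ; adj   = p4adj
  ; sym   = from-yes (all? λ i → all? λ j → p4adj i j ≟ᵇ p4adj j i)
  ; irrfl = from-yes (all? λ i → p4adj i i ≟ᵇ false)
  }

bowtieAdj : Fin 5 → Fin 5 → Bool
bowtieAdj 0F 1F = true
bowtieAdj 0F 2F = true
bowtieAdj 0F 3F = true
bowtieAdj 0F 4F = true
bowtieAdj 1F 0F = true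
bowtieAdj 2F 0F = true
bowtieAdj 3F 0F = true
bowtieAdj 4F 0F = true
bowtieAdj 1F 2F = true
bowtieAdj 2F 1F = true
bowtieAdj 3F 4F = true
bowtieAdj 4F 3F = true
bowtieAdj _  _  = false

Bowtie : Graph
Bowtie = record
  { n     = 5
  ; adj   = bowtieAdj
  ; sym   = from-yes (all? λ i → all? λ j → bowtieAdj i j ≟ᵇ bowtieAdj j i)
  ; irrfl = from-yes (all? λ i → bowtieAdj i i ≟ᵇ false)
  }

P4-connected : Connected P4
P4-connected = s≤s z≤n , connected-from-root (Graph.sym P4) 0F reach
  where
  reach : ∀ i → Reach p4adj 0F i
  reach 0F = here
  reach 1F = edge refl
  reach 2F = step {k = 1F} refl (edge refl)
  reach 3F = step {k = 1F} refl (step {k = 2F} refl (edge refl))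

Bowtie-connected : Connected Bowtie
Bowtie-connected = s≤s z≤n , connected-from-root (Graph.sym Bowtie) 0F reach
  where
  reach : ∀ i → Reach bowtieAdj 0F i
  reach 0F = here
  reach 1F = edge refl
  reach 2F = edge refl
  reach 3F = edge refl
  reach 4F = edge refl

-- The middle edge 1 2 is a minimum edge cut.
P4-not-superEdgeConnected : ¬ SuperEdgeConnected P4
P4-not-superEdgeConnected =
  ¬superEdgeConnected P4 {∂ P4 (_<ᶠ 2F)}
    (∂-isEdgeCut P4 (_<ᶠ 2F) {0F} {3F} refl refl ,
     λ F F-cut → size-of-cut≥1 P4 P4-connected {F} F-cut)
    {1F} {2F} {0F} {3F} refl refl refl refl refl

-- The edges 0 1 and 0 2 form a minimum edge cut.
Bowtie-not-superEdgeConnected : ¬ SuperEdgeConnected Bowtie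
Bowtie-not-superEdgeConnected =
  ¬superEdgeConnected Bowtie {∂ Bowtie wing}
    (∂-isEdgeCut Bowtie wing {1F} {0F} refl refl ,
     λ F F-cut → size-of-cut≥2 Bowtie Bowtie-connected {F} F-cut λ {u} {v} → triangulated u v)
    {0F} {1F} {3F} {2F} refl refl refl refl refl
  where
  wing : Fin 5 → Bool
  wing i = is 1F i ∨ is 2F i
  triangulated : ∀ u v → bowtieAdj u v ≡ true → ∃ λ w → bowtieAdj u w ≡ true × bowtieAdj w v ≡ true
  triangulated = from-yes (all? λ u → all? λ v → (bowtieAdj u v ≟ᵇ true) →-dec
                   any? λ w → (bowtieAdj u w ≟ᵇ true) ×-dec (bowtieAdj w v ≟ᵇ true))

P4-triangle-free : ∀ a b c → p4adj a b ≡ true → p4adj b c ≡ true → p4adj a c ≡ true → ⊥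
P4-triangle-free = from-yes (all? λ a → all? λ b → all? λ c →
  (p4adj a b ≟ᵇ true) →-dec (p4adj b c ≟ᵇ true) →-dec (p4adj a c ≟ᵇ true) →-dec no id)

Bowtie-P4-free : Free P4 Bowtie
Bowtie-P4-free (h , _ , h-adj) =
  no-induced-path (h 0F) (h 1F) (h 2F) (h 3F)
    (sym (h-adj 0F 1F)) (sym (h-adj 1F 2F)) (sym (h-adj 2F 3F))
    (sym (h-adj 0F 2F)) (sym (h-adj 1F 3F)) (sym (h-adj 0F 3F))
  where
  no-induced-path : ∀ a b c d → bowtieAdj a b ≡ true → bowtieAdj b c ≡ true → bowtieAdj c d ≡ true →
                    bowtieAdj a c ≡ false → bowtieAdj b d ≡ false → bowtieAdj a d ≡ false → ⊥
  no-induced-path = from-yes (all? λ a → all? λ b → all? λ c → all? λ d →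
    (bowtieAdj a b ≟ᵇ true) →-dec (bowtieAdj b c ≟ᵇ true) →-dec (bowtieAdj c d ≟ᵇ true) →-dec
    (bowtieAdj a c ≟ᵇ false) →-dec (bowtieAdj b d ≟ᵇ false) →-dec (bowtieAdj a d ≟ᵇ false) →-dec
    no id)

-- Small connected graphs

induced-in-P4-and-Bowtie⇒order≤3 : ∀ (S : Graph) →
                                   ¬ ¬ InducedSubgraph S P4 → ¬ ¬ InducedSubgraph S Bowtie → n S ≤ 3
induced-in-P4-and-Bowtie⇒order≤3 S ¬¬S⊆P4 ¬¬S⊆Bowtie =
  decidable-stable (n S ≤? 3) λ n≰3 → ¬¬S⊆P4 λ S⊆P4 → ¬¬S⊆Bowtie λ S⊆Bowtie →
  Bowtie-P4-free (induced-trans {P4} {S} {Bowtie} (induced-invert {S} {P4} S⊆P4 (≰⇒> n≰3)) S⊆Bowtie)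

connected-order≤3⇒induced-in-P3 : ∀ (S : Graph) → Connected S → n S ≤ 3 → ¬ ¬ InducedSubgraph S P4 →
                                  InducedSubgraph S P3
connected-order≤3⇒induced-in-P3 record { n = 0 } (() , _) _ _
connected-order≤3⇒induced-in-P3 S@record { n = 1 } _ _ _ =
  (λ _ → 0F) , (λ { {0F} {0F} _ → refl }) , λ { 0F 0F → irrfl S 0F }
connected-order≤3⇒induced-in-P3 S@record { n = 2 } (_ , reach) _ _
  with adjacent-or-inducedP3 S (reach 0F 1F) (λ ())
... | inj₂ (_ , P3↪S , _) = contradiction (injective⇒≤ P3↪S) λ { (s≤s (s≤s ())) }
... | inj₁ s01 = inject₁ , inject₁-injective , λ where
  0F 0F → irrfl S 0F
  0F 1F → s01
  1F 0F → trans (Graph.sym S 1F 0F) s01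
  1F 1F → irrfl S 1F
connected-order≤3⇒induced-in-P3 S@record { n = 3 } (_ , reach) _ ¬¬S⊆P4
  with adjacent-or-inducedP3 S (reach 0F 1F) (λ ())
     | adjacent-or-inducedP3 S (reach 0F 2F) (λ ())
     | adjacent-or-inducedP3 S (reach 1F 2F) (λ ())
... | inj₂ P3⊆S | _ | _ = induced-invert {P3} {S} P3⊆S ≤-refl
... | _ | inj₂ P3⊆S | _ = induced-invert {P3} {S} P3⊆S ≤-refl
... | _ | _ | inj₂ P3⊆S = induced-invert {P3} {S} P3⊆S ≤-refl
... | inj₁ s01 | inj₁ s02 | inj₁ s12 = contradiction (λ (f , _ , f-adj) →
  P4-triangle-free (f 0F) (f 1F) (f 2F)
    (trans (sym (f-adj 0F 1F)) s01) (trans (sym (f-adj 1F 2F)) s12) (trans (sym (f-adj 0F 2F)) s02))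
  ¬¬S⊆P4
connected-order≤3⇒induced-in-P3 record { n = suc (suc (suc (suc _))) } _ (s≤s (s≤s (s≤s ()))) _

theorem2p1 : (S : Graph) → Connected S →
    ((∀ (G : Graph) → Connected G → Free S G → SuperEdgeConnected G) → InducedSubgraph S P3)
    × (InducedSubgraph S P3 → ∀ (G : Graph) → Connected G → Free S G → SuperEdgeConnected G)
theorem2p1 S S-conn = only-if , if
  where
  only-if : (∀ (G : Graph) → Connected G → Free S G → SuperEdgeConnected G) → InducedSubgraph S P3
  only-if sec = connected-order≤3⇒induced-in-P3 S S-conn
                  (induced-in-P4-and-Bowtie⇒order≤3 S ¬¬S⊆P4 ¬¬S⊆Bowtie) ¬¬S⊆P4
    where
    ¬¬S⊆P4 : ¬ ¬ InducedSubgraph S P4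
    ¬¬S⊆P4 S-free = P4-not-superEdgeConnected (sec P4 P4-connected S-free)
    ¬¬S⊆Bowtie : ¬ ¬ InducedSubgraph S Bowtie
    ¬¬S⊆Bowtie S-free = Bowtie-not-superEdgeConnected (sec Bowtie Bowtie-connected S-free)
  if : InducedSubgraph S P3 → ∀ (G : Graph) → Connected G → Free S G → SuperEdgeConnected G
  if S⊆P3 G G-conn S-free = complete⇒superEdgeConnected G G-conn
    (P3-free⇒complete G G-conn λ P3⊆G → S-free (induced-trans {S} {P3} {G} S⊆P3 P3⊆G))
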